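{- Let $T$ be a finite tree and $S\in\mathcal{F}_{S}(T)$. Then: (1) $\operatorname{Supp}(S)=\operatorname{Supp}(T)\cap V(S)$; (2) $\operatorname{Supp}(T)=\bigcup_{S'\in\mathcal{F}_{S}(T)}\operatorname{Supp}(S')$; (3) $\operatorname{Core}(S)=\operatorname{Core}(T)\cap V(S)$; (4) $\operatorname{Core}(T)=\bigcup_{S'\in\mathcal{F}_{S}(T)}\operatorname{Core}(S')$; (5) if $x\in\mathcal{N}(T)$, then the restriction $x|_{V(S)}\in\mathcal{N}(S)$; (6) if $x\in\mathcal{N}(S)$, then its extension by zero $\uparrow_S^T x\in\mathcal{N}(T)$.
   Context: For a tree $G$, $\mathcal{N}(G)\subseteq\mathbb{R}^{V(G)}$ is the null space of its adjacency matrix, $\operatorname{Supp}(G)=\{w\in V(G): x_w\neq0\text{ for some }x\in\mathcal{N}(G)\}$, and $\operatorname{Core}(G)=\bigcup_{w\in\operatorname{Supp}(G)}N_G(w)$. $N[X]=\bigcup_{w\in X}(N(w)\cup\{w\})$. $\mathcal{F}_{S}(T)$ is the set of connected components of the induced subgraph $T\langle N[\operatorname{Supp}(T)]\rangle$. For $x\in\mathbb{R}^{V(S)}$, $\uparrow_S^T x\in\mathbb{R}^{V(T)}$ agrees with $x$ on $V(S)$ and is $0$ elsewhere.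
   Formalization: The null spaces $\mathcal{N}(T)$ and $\mathcal{N}(S)$, and with them Supp and Core, are taken over ℚ instead of ℝ, so the vectors x in parts (5) and (6) have rational entries. -}

module Defs where

open import Data.Nat using (ℕ; zero; suc; _≤_)
open import Data.Fin using (Fin)
open import Data.Fin.Subset using (Subset; _∈_)
open import Data.Fin.Subset.Properties using (_∈?_)
open import Data.Bool using (Bool; true; false; T; if_then_else_; _∧_)
open import Data.Rational using (ℚ; 0ℚ; _+_)
open import Data.List using (List; []; _∷_; _++_; length)
open import Data.List.Relation.Unary.Linked using (Linked)
open import Data.List.Relation.Unary.Unique.Propositional using (Unique)
open import Data.Product using (Σ; ∃; _×_; _,_)
open import Data.Sum using (_⊎_)
open import Data.Unit using () renaming (⊤ to Unit)
open import Relation.Nullary using (¬_; does)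
open import Relation.Binary.PropositionalEquality using (_≡_; _≢_)

record Graph (n : ℕ) : Set where
  field
    adj    : Fin n → Fin n → Bool
    sym    : ∀ u v → adj u v ≡ adj v u
    irrefl : ∀ v → adj v v ≡ false
open Graph public

Adj : ∀ {n} → Graph n → Fin n → Fin n → Set
Adj G u v = T (adj G u v)

VPred : ℕ → Set₁
VPred n = Fin n → Set

-- Walks from u to v all of whose vertices lie in X
-- (i.e. walks in the induced subgraph G⟨X⟩).
data Walk {n : ℕ} (G : Graph n) (X : VPred n) : Fin n → Fin n → Set where
  stop : ∀ {u} → X u → Walk G X u u
  step : ∀ {u w v} → X u → Adj G u w → Walk G X w v → Walk G X u v

AllV : ∀ {n} → VPred n
AllV _ = Unit

Connected : ∀ {n} → Graph n → Set
Connected G = ∀ u v → Walk G AllV u v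

-- A cycle: distinct vertices u, w₁ … wₖ, v (k ≥ 1, so ≥ 3 vertices),
-- consecutive ones adjacent, and v adjacent to u.
HasCycle : ∀ {n} → Graph n → Set
HasCycle {n} G =
  Σ (Fin n) λ u → Σ (List (Fin n)) λ ws → Σ (Fin n) λ v →
    1 ≤ length ws
    × Unique (u ∷ ws ++ (v ∷ []))
    × Linked (Adj G) (u ∷ ws ++ (v ∷ []))
    × Adj G v u

IsTree : ∀ {n} → Graph n → Set
IsTree {n} G = 1 ≤ n × Connected G × ¬ HasCycle G

Σℚ : ∀ {n} → (Fin n → ℚ) → ℚ
Σℚ {zero}  f = 0ℚ
Σℚ {suc n} f = f Fin.zero + Σℚ (λ i → f (Fin.suc i))

-- Vectors on V(S) are represented by x : Fin n → ℚ; only the values on S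
-- matter.
Null : ∀ {n} → Graph n → Subset n → (Fin n → ℚ) → Set
Null G S x =
  ∀ v → v ∈ S →
    Σℚ (λ w → if adj G v w ∧ does (w ∈? S) then x w else 0ℚ) ≡ 0ℚ

Supp : ∀ {n} → Graph n → Subset n → VPred n
Supp {n} G S w = w ∈ S × Σ (Fin n → ℚ) (λ x → Null G S x × x w ≢ 0ℚ)

Core : ∀ {n} → Graph n → Subset n → VPred n
Core {n} G S v = v ∈ S × Σ (Fin n) (λ u → Supp G S u × Adj G u v)

ClosedNbhd : ∀ {n} → Graph n → VPred n → VPred n
ClosedNbhd {n} G X v = Σ (Fin n) (λ u → X u × (u ≡ v ⊎ Adj G u v))

IsComponent : ∀ {n} → Graph n → VPred n → Subset n → Set
IsComponent {n} G X S =
  Σ (Fin n) λ u → X u × (∀ v → (v ∈ S → Walk G X u v) × (Walk G X u v → v ∈ S))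

InFS : ∀ {n} → Graph n → Subset n → Set
InFS G S = IsComponent G (ClosedNbhd G (Supp G Data.Fin.Subset.⊤)) S

extend : ∀ {n} → Subset n → (Fin n → ℚ) → (Fin n → ℚ)
extend S x w = if does (w ∈? S) then x w else 0ℚ

{-# OPTIONS --safe #-}
-- Let S be a component of T⟨N[Supp T]⟩. A null vector of T
-- restricts to one of T⟨S⟩, because a neighbour of S outside S lies outside Supp T. Conversely,
-- a null vector x of T⟨S⟩ extends by zero as soon as x_w = 0 for every w ∈ S with a neighbour
-- v ∉ S. Such a w is not in Supp T, yet lies in N[Supp T], so it has a neighbour u ∈ Supp T ∩ S,
-- witnessed by some y ∈ 𝒩(T) with y_u ≠ 0 = y_w. Summing y_s (A_S x)_s − x_s (A_S y)_s = 0 over the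
-- branch of T⟨S⟩ − u containing w, the edges inside the branch cancel in pairs and, T being
-- acyclic, wu is the only edge of T⟨S⟩ leaving it; hence y_w x_u = x_w y_u, so x_w = 0.
-- Parts (1)–(4) follow from (5) and (6). Producing the component of a given vertex requires
-- Supp T to be decidable: membership is the solvability of a linear system over ℚ.
module Submission where

open import Defs hiding (sym)
open import Algebra.Bundles using (Ring)
open import Data.Bool using (Bool; true; false; T; not; _∧_; if_then_else_)
open import Data.Bool.Properties using (T?; T-≡)
open import Data.Empty using (⊥; ⊥-elim)
open import Data.Fin using (Fin; zero; suc)
open import Data.Fin.Properties using (any?; injective⇒≤; suc-injective) renaming (_≟_ to _≟ᶠ_)
open import Data.Fin.Subset using (Subset; _∈_; _∉_; ⊤)
open import Data.Fin.Subset.Properties using (_∈?_; ∈⊤)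
open import Data.List using (List; []; _∷_; _++_; length; lookup; map; filter; allFin)
open import Data.List.Membership.Propositional using (find) renaming (_∈_ to _∈ₗ_)
open import Data.List.Membership.Propositional.Properties using (∈-filter⁺; ∈-filter⁻; ∈-allFin; ∈-lookup)
open import Data.List.Properties using (length-++-≤ˡ)
open import Data.List.Relation.Unary.All as All using (All; []; _∷_)
open import Data.List.Relation.Unary.All.Properties using (map⁺; map⁻; ¬Any⇒All¬)
open import Data.List.Relation.Unary.AllPairs using ([]; _∷_)
open import Data.List.Relation.Unary.Any using (here; there) renaming (any? to anyₗ?)
open import Data.List.Relation.Unary.Linked using (Linked; []; [-]; _∷_)
open import Data.List.Relation.Unary.Unique.Propositional using (Unique)
open import Data.Nat using (ℕ; zero; suc; _≤_; z≤n; s≤s)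
open import Data.Nat.Properties using (≤-trans)
open import Data.Product using (Σ; _×_; _,_; proj₁; proj₂)
open import Data.Rational using (ℚ; 0ℚ; 1ℚ; ½; _+_; _*_; -_; _-_; 1/_; ≢-nonZero)
open import Data.Rational.Properties
  using ( _≟_; +-*-ring; +-*-commutativeRing; +-0-group; +-identityˡ; +-identityʳ; +-inverseʳ
        ; *-zeroˡ; *-zeroʳ; *-identityˡ; *-identityʳ; *-assoc; *-inverseˡ; *-inverseʳ)
open import Data.Sum using (_⊎_; inj₁; inj₂)
open import Data.Vec as Vec using (tabulate)
import Data.Vec.Functional as Vector
open import Data.Vec.Properties using (lookup∘tabulate; lookup⇒[]=; []=⇒lookup)
open import Function.Base using (_∘_)
open import Function.Bundles using (_⇔_; mk⇔; Equivalence)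
open import Function.Properties.Equivalence using () renaming (sym to ⇔-sym)
open import Level using (0ℓ)
open import Relation.Binary.PropositionalEquality
open import Relation.Nullary using (¬_; Dec; yes; no; does; dec⇒maybe; ¬?; _×-dec_; _⊎-dec_)
open import Relation.Nullary.Decidable
  using (decidable-stable; dec-true; dec-false) renaming (map to Dec-map; map′ to Dec-map′)
open import Relation.Unary using (Decidable)
open import Tactic.RingSolver using (solve-∀)
open import Tactic.RingSolver.Core.AlmostCommutativeRing using (AlmostCommutativeRing; fromCommutativeRing)

open import Algebra.Properties.Group +-0-group using (x∙y⁻¹≈ε⇒x≈y)
open import Algebra.Properties.Semiring.Sum (Ring.semiring +-*-ring)
  using (sum; sum-cong-≗; sum-replicate-zero; ∑-distrib-+; ∑-comm; *-distribˡ-sum)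

ℚ-ring : AlmostCommutativeRing 0ℓ 0ℓ
ℚ-ring = fromCommutativeRing +-*-commutativeRing (λ q → dec⇒maybe (0ℚ ≟ q))

p+p≡0⇒p≡0 : ∀ p → p + p ≡ 0ℚ → p ≡ 0ℚ
p+p≡0⇒p≡0 p p+p≡0 = begin
  p            ≡⟨ halve p ⟩
  (p + p) * ½  ≡⟨ cong (_* ½) p+p≡0 ⟩
  0ℚ * ½       ≡⟨ *-zeroˡ ½ ⟩
  0ℚ           ∎
  where
  open ≡-Reasoning
  halve : ∀ p → p ≡ (p + p) * ½
  halve = solve-∀ ℚ-ring

p*q≡0⇒p≡0 : ∀ p q → q ≢ 0ℚ → p * q ≡ 0ℚ → p ≡ 0ℚ
p*q≡0⇒p≡0 p q q≢0 pq≡0 = begin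
  p              ≡⟨ *-identityʳ p ⟨
  p * 1ℚ         ≡⟨ cong (p *_) (*-inverseʳ q {{q≠0}}) ⟨
  p * (q * q⁻¹)  ≡⟨ *-assoc p q q⁻¹ ⟨
  (p * q) * q⁻¹  ≡⟨ cong (_* q⁻¹) pq≡0 ⟩
  0ℚ * q⁻¹       ≡⟨ *-zeroˡ q⁻¹ ⟩
  0ℚ             ∎
  where
  open ≡-Reasoning
  q≠0 = ≢-nonZero q≢0
  q⁻¹ = 1/_ q {{q≠0}}

p-r*q≡0 : ∀ {p q} r → p ≡ 0ℚ → q ≡ 0ℚ → p - r * q ≡ 0ℚ
p-r*q≡0 r refl refl = vanish r
  where
  vanish : ∀ r → 0ℚ - r * 0ℚ ≡ 0ℚ
  vanish = solve-∀ ℚ-ring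

p-r*q≡0⇒p≡0 : ∀ {p q} r → p - r * q ≡ 0ℚ → q ≡ 0ℚ → p ≡ 0ℚ
p-r*q≡0⇒p≡0 {p} r p-rq≡0 refl = trans (vanish p r) p-rq≡0
  where
  vanish : ∀ p r → p ≡ p - r * 0ℚ
  vanish = solve-∀ ℚ-ring

Σℚ≡sum : ∀ {n} (f : Fin n → ℚ) → Σℚ f ≡ sum f
Σℚ≡sum {zero}  f = refl
Σℚ≡sum {suc n} f = cong (f zero +_) (Σℚ≡sum (λ i → f (suc i)))

module _ {n : ℕ} where

  Σℚ-cong : {f g : Fin n → ℚ} → (∀ i → f i ≡ g i) → Σℚ f ≡ Σℚ g
  Σℚ-cong {f} {g} f≗g = trans (Σℚ≡sum f) (trans (sum-cong-≗ f≗g) (sym (Σℚ≡sum g)))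

  Σℚ-zero : {f : Fin n → ℚ} → (∀ i → f i ≡ 0ℚ) → Σℚ f ≡ 0ℚ
  Σℚ-zero f≗0 = trans (Σℚ-cong f≗0) (trans (Σℚ≡sum {n} (λ _ → 0ℚ)) (sum-replicate-zero n))

  Σℚ-+ : ∀ (f g : Fin n → ℚ) → Σℚ (λ i → f i + g i) ≡ Σℚ f + Σℚ g
  Σℚ-+ f g = begin
    Σℚ (λ i → f i + g i)  ≡⟨ Σℚ≡sum (λ i → f i + g i) ⟩
    sum (λ i → f i + g i) ≡⟨ ∑-distrib-+ f g ⟩
    sum f + sum g         ≡⟨ cong₂ _+_ (Σℚ≡sum f) (Σℚ≡sum g) ⟨
    Σℚ f + Σℚ g           ∎
    where open ≡-Reasoning

  Σℚ-*ˡ : ∀ a (f : Fin n → ℚ) → Σℚ (λ i → a * f i) ≡ a * Σℚ f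
  Σℚ-*ˡ a f = begin
    Σℚ (λ i → a * f i)  ≡⟨ Σℚ≡sum (λ i → a * f i) ⟩
    sum (λ i → a * f i) ≡⟨ *-distribˡ-sum a f ⟨
    a * sum f           ≡⟨ cong (a *_) (Σℚ≡sum f) ⟨
    a * Σℚ f            ∎
    where open ≡-Reasoning

  Σℚ-linear : ∀ a b (f g : Fin n → ℚ) → Σℚ (λ i → a * f i + b * g i) ≡ a * Σℚ f + b * Σℚ g
  Σℚ-linear a b f g =
    trans (Σℚ-+ (λ i → a * f i) (λ i → b * g i)) (cong₂ _+_ (Σℚ-*ˡ a f) (Σℚ-*ˡ b g))

Σℚ-δ : ∀ {n} (i : Fin n) {f : Fin n → ℚ} → (∀ j → j ≢ i → f j ≡ 0ℚ) → Σℚ f ≡ f i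
Σℚ-δ zero    {f} f≡0 =
  trans (cong (f zero +_) (Σℚ-zero {f = f ∘ suc} (λ j → f≡0 (suc j) λ ())))
        (+-identityʳ (f zero))
Σℚ-δ (suc i) {f} f≡0 =
  trans (cong₂ _+_ (f≡0 zero λ ()) (Σℚ-δ i {f ∘ suc} (λ j j≢i → f≡0 (suc j) (j≢i ∘ suc-injective))))
        (+-identityˡ (f (suc i)))

Σℚ-comm : ∀ {m n} (F : Fin m → Fin n → ℚ) → Σℚ (λ i → Σℚ (F i)) ≡ Σℚ (λ j → Σℚ (λ i → F i j))
Σℚ-comm F = begin
  Σℚ (λ i → Σℚ (F i))              ≡⟨ Σℚ-cong (λ i → Σℚ≡sum (F i)) ⟩
  Σℚ (λ i → sum (F i))             ≡⟨ Σℚ≡sum (λ i → sum (F i)) ⟩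
  sum (λ i → sum (F i))            ≡⟨ ∑-comm F ⟩
  sum (λ j → sum (λ i → F i j))    ≡⟨ Σℚ≡sum (λ j → sum (λ i → F i j)) ⟨
  Σℚ (λ j → sum (λ i → F i j))     ≡⟨ Σℚ-cong (λ j → Σℚ≡sum (λ i → F i j)) ⟨
  Σℚ (λ j → Σℚ (λ i → F i j))      ∎
  where open ≡-Reasoning

ΣΣ-antisym≡0 : ∀ {n} (F : Fin n → Fin n → ℚ) → (∀ i j → F j i ≡ - F i j) → Σℚ (λ i → Σℚ (F i)) ≡ 0ℚ
ΣΣ-antisym≡0 F antisym = p+p≡0⇒p≡0 _ (begin
  ΣΣF + ΣΣF                                        ≡⟨ cong (ΣΣF +_) (Σℚ-comm F) ⟩
  ΣΣF + Σℚ (λ i → Σℚ (λ j → F j i))                ≡⟨ Σℚ-+ (λ i → Σℚ (F i)) (λ i → Σℚ (λ j → F j i)) ⟨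
  Σℚ (λ i → Σℚ (F i) + Σℚ (λ j → F j i))          ≡⟨ Σℚ-cong (λ i → Σℚ-+ (F i) (λ j → F j i)) ⟨
  Σℚ (λ i → Σℚ (λ j → F i j + F j i))             ≡⟨ Σℚ-zero (λ i → Σℚ-zero (λ j → cancel i j)) ⟩
  0ℚ                                               ∎)
  where
  open ≡-Reasoning
  ΣΣF = Σℚ (λ i → Σℚ (F i))
  cancel : ∀ i j → F i j + F j i ≡ 0ℚ
  cancel i j = trans (cong (F i j +_) (antisym i j)) (+-inverseʳ (F i j))

-- Solvability of affine systems over ℚ is decidable (Gaussian elimination)

AffineForm : ℕ → Set
AffineForm k = (Fin k → ℚ) × ℚ

eval : ∀ {k} → AffineForm k → (Fin k → ℚ) → ℚ
eval (a , c) x = Σℚ (λ i → a i * x i) + c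

Solvable : ∀ {k} → List (AffineForm k) → Set
Solvable {k} es = Σ (Fin k → ℚ) λ x → All (λ e → eval e x ≡ 0ℚ) es

_-[_]·_ : ∀ {k} → AffineForm k → ℚ → AffineForm k → AffineForm k
(a , c) -[ l ]· (b , d) = (λ i → a i - l * b i) , c - l * d

eval-sub : ∀ {k} e l p (x : Fin k → ℚ) → eval (e -[ l ]· p) x ≡ eval e x - l * eval p x
eval-sub (a , c) l (b , d) x = begin
  Σℚ (λ i → (a i - l * b i) * x i) + (c - l * d)
    ≡⟨ cong (_+ (c - l * d)) (Σℚ-cong λ i → split (a i) (b i) (x i) l) ⟩
  Σℚ (λ i → 1ℚ * (a i * x i) + (- l) * (b i * x i)) + (c - l * d)
    ≡⟨ cong (_+ (c - l * d)) (Σℚ-linear 1ℚ (- l) (λ i → a i * x i) (λ i → b i * x i)) ⟩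
  1ℚ * Σℚ (λ i → a i * x i) + (- l) * Σℚ (λ i → b i * x i) + (c - l * d)
    ≡⟨ regroup (Σℚ (λ i → a i * x i)) (Σℚ (λ i → b i * x i)) c d l ⟩
  (Σℚ (λ i → a i * x i) + c) - l * (Σℚ (λ i → b i * x i) + d) ∎
  where
  open ≡-Reasoning
  split : ∀ a b x l → (a - l * b) * x ≡ 1ℚ * (a * x) + (- l) * (b * x)
  split = solve-∀ ℚ-ring
  regroup : ∀ A B c d l → 1ℚ * A + (- l) * B + (c - l * d) ≡ (A + c) - l * (B + d)
  regroup = solve-∀ ℚ-ring

dropFirst : ∀ {k} → AffineForm (suc k) → AffineForm k
dropFirst (a , c) = Vector.tail a , c

eval-dropFirst : ∀ {k} e (x : Fin (suc k) → ℚ) → proj₁ e zero ≡ 0ℚ →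
                 eval (dropFirst e) (Vector.tail x) ≡ eval e x
eval-dropFirst (a , c) x a₀≡0 = cong (_+ c) (sym (begin
  a zero * x zero + rest  ≡⟨ cong (λ a₀ → a₀ * x zero + rest) a₀≡0 ⟩
  0ℚ * x zero + rest      ≡⟨ cong (_+ rest) (*-zeroˡ (x zero)) ⟩
  0ℚ + rest               ≡⟨ +-identityˡ rest ⟩
  rest                    ∎))
  where
  open ≡-Reasoning
  rest = Σℚ (λ i → a (suc i) * x (suc i))

module Pivot {k} (p : AffineForm (suc k)) (p₀≢0 : proj₁ p zero ≢ 0ℚ) where

  p₀⁻¹ : ℚ
  p₀⁻¹ = 1/_ (proj₁ p zero) {{≢-nonZero p₀≢0}}

  ratio : AffineForm (suc k) → ℚ
  ratio e = proj₁ e zero * p₀⁻¹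

  eliminate : AffineForm (suc k) → AffineForm k
  eliminate e = dropFirst (e -[ ratio e ]· p)

  eval-eliminate : ∀ e (x : Fin (suc k) → ℚ) →
                   eval (eliminate e) (Vector.tail x) ≡ eval e x - ratio e * eval p x
  eval-eliminate e x = trans (eval-dropFirst (e -[ ratio e ]· p) x leading≡0) (eval-sub e (ratio e) p x)
    where
    leading≡0 : proj₁ e zero - ratio e * proj₁ p zero ≡ 0ℚ
    leading≡0 = begin
      e₀ - e₀ * p₀⁻¹ * p₀   ≡⟨ reassoc e₀ p₀⁻¹ p₀ ⟩
      e₀ - e₀ * (p₀ * p₀⁻¹) ≡⟨ cong (λ z → e₀ - e₀ * z) (*-inverseʳ p₀ {{≢-nonZero p₀≢0}}) ⟩
      e₀ - e₀ * 1ℚ          ≡⟨ vanish e₀ ⟩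
      0ℚ                    ∎
      where
      open ≡-Reasoning
      e₀ = proj₁ e zero
      p₀ = proj₁ p zero
      reassoc : ∀ e q p → e - e * q * p ≡ e - e * (p * q)
      reassoc = solve-∀ ℚ-ring
      vanish : ∀ e → e - e * 1ℚ ≡ 0ℚ
      vanish = solve-∀ ℚ-ring

  backSubstitute : (Fin k → ℚ) → Fin (suc k) → ℚ
  backSubstitute y = (- eval (dropFirst p) y * p₀⁻¹) Vector.∷ y

  eval-backSubstitute : ∀ y → eval p (backSubstitute y) ≡ 0ℚ
  eval-backSubstitute y = begin
    p₀ * (- (S + d) * p₀⁻¹) + S + d   ≡⟨ regroup p₀ p₀⁻¹ S d ⟩
    - (S + d) * (p₀ * p₀⁻¹) + (S + d) ≡⟨ cong (λ z → - (S + d) * z + (S + d))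
                                               (*-inverseʳ p₀ {{≢-nonZero p₀≢0}}) ⟩
    - (S + d) * 1ℚ + (S + d)          ≡⟨ vanish (S + d) ⟩
    0ℚ                                ∎
    where
    open ≡-Reasoning
    p₀ = proj₁ p zero
    d = proj₂ p
    S = Σℚ (λ i → proj₁ p (suc i) * y i)
    regroup : ∀ a q S d → a * (- (S + d) * q) + S + d ≡ - (S + d) * (a * q) + (S + d)
    regroup = solve-∀ ℚ-ring
    vanish : ∀ v → - v * 1ℚ + v ≡ 0ℚ
    vanish = solve-∀ ℚ-ring

  solvable-eliminate : ∀ {es} → p ∈ₗ es → Solvable es ⇔ Solvable (map eliminate es)
  solvable-eliminate {es} p∈es = mk⇔ forward backward
    where
    forward : Solvable es → Solvable (map eliminate es)
    forward (x , x⊨es) = Vector.tail x , map⁺ (All.map (λ {e} e[x]≡0 →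
      trans (eval-eliminate e x) (p-r*q≡0 (ratio e) e[x]≡0 (All.lookup x⊨es p∈es))) x⊨es)
    backward : Solvable (map eliminate es) → Solvable es
    backward (y , y⊨es′) = backSubstitute y , All.map (λ {e} e′[y]≡0 →
      p-r*q≡0⇒p≡0 (ratio e) (trans (sym (eval-eliminate e (backSubstitute y))) e′[y]≡0)
                             (eval-backSubstitute y)) (map⁻ y⊨es′)

solvable-dropFirst : ∀ {k} {es : List (AffineForm (suc k))} → All (λ e → proj₁ e zero ≡ 0ℚ) es →
                     Solvable es ⇔ Solvable (map dropFirst es)
solvable-dropFirst {es = es} es₀≡0 = mk⇔ forward backward
  where
  forward : Solvable es → Solvable (map dropFirst es)
  forward (x , x⊨es) = Vector.tail x , map⁺ (All.zipWith (λ {e} (e₀≡0 , e[x]≡0) →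
    trans (eval-dropFirst e x e₀≡0) e[x]≡0) (es₀≡0 , x⊨es))
  backward : Solvable (map dropFirst es) → Solvable es
  backward (y , y⊨es′) = 0ℚ Vector.∷ y , All.zipWith (λ {e} (e₀≡0 , e′[y]≡0) →
    trans (sym (eval-dropFirst e (0ℚ Vector.∷ y) e₀≡0)) e′[y]≡0) (es₀≡0 , map⁻ y⊨es′)

solvable? : ∀ {k} (es : List (AffineForm k)) → Dec (Solvable es)
solvable? {zero} es = Dec-map′ ((λ ()) ,_) proj₂ (All.all? (λ e → eval e (λ ()) ≟ 0ℚ) es)
solvable? {suc k} es with anyₗ? (λ e → ¬? (proj₁ e zero ≟ 0ℚ)) es
... | yes ∃pivot = let p , p∈es , p₀≢0 = find ∃pivot; open Pivot p p₀≢0 in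
  Dec-map (⇔-sym (solvable-eliminate p∈es)) (solvable? (map eliminate es))
... | no ∄pivot = Dec-map (⇔-sym (solvable-dropFirst es₀≡0)) (solvable? (map dropFirst es))
  where
  es₀≡0 : All (λ e → proj₁ e zero ≡ 0ℚ) es
  es₀≡0 = All.map (decidable-stable (_ ≟ 0ℚ)) (¬Any⇒All¬ es ∄pivot)

-- Null vectors of induced subgraphs; membership in the support is decidable

𝟙 : Bool → ℚ
𝟙 b = if b then 1ℚ else 0ℚ

𝟙-* : ∀ b q → 𝟙 b * q ≡ (if b then q else 0ℚ)
𝟙-* true  q = *-identityˡ q
𝟙-* false q = *-zeroˡ q

if-*ˡ : ∀ b l q → (if b then l * q else 0ℚ) ≡ l * (if b then q else 0ℚ)
if-*ˡ true  l q = refl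
if-*ˡ false l q = sym (*-zeroʳ l)

module _ {n : ℕ} (G : Graph n) (S : Subset n) where

  adjTerm : (Fin n → ℚ) → Fin n → Fin n → ℚ
  adjTerm x v w = if adj G v w ∧ does (w ∈? S) then x w else 0ℚ

  adjSum : (Fin n → ℚ) → Fin n → ℚ
  adjSum x v = Σℚ (adjTerm x v)

  adjSum-*ˡ : ∀ l x v → adjSum (λ w → l * x w) v ≡ l * adjSum x v
  adjSum-*ˡ l x v = trans (Σℚ-cong (λ w → if-*ˡ _ l (x w))) (Σℚ-*ˡ l (adjTerm x v))

  Null-*ˡ : ∀ l {x} → Null G S x → Null G S (λ w → l * x w)
  Null-*ˡ l {x} x-null v v∈S = trans (adjSum-*ˡ l x v) (trans (cong (l *_) (x-null v v∈S)) (*-zeroʳ l))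

  adjRow : Fin n → AffineForm n
  adjRow v = (λ w → 𝟙 (adj G v w ∧ does (w ∈? S))) , 0ℚ

  eval-adjRow : ∀ v x → eval (adjRow v) x ≡ adjSum x v
  eval-adjRow v x = trans (+-identityʳ _) (Σℚ-cong (λ w → 𝟙-* _ (x w)))

  pin : Fin n → AffineForm n
  pin v = (λ w → 𝟙 (does (w ≟ᶠ v))) , - 1ℚ

  eval-pin : ∀ v x → eval (pin v) x ≡ x v - 1ℚ
  eval-pin v x = cong (_- 1ℚ) (begin
    Σℚ (λ w → 𝟙 (does (w ≟ᶠ v)) * x w) ≡⟨ Σℚ-δ v off-v ⟩
    𝟙 (does (v ≟ᶠ v)) * x v             ≡⟨ cong (λ b → 𝟙 b * x v) (dec-true (v ≟ᶠ v) refl) ⟩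
    1ℚ * x v                            ≡⟨ *-identityˡ (x v) ⟩
    x v                                 ∎)
    where
    open ≡-Reasoning
    off-v : ∀ w → w ≢ v → 𝟙 (does (w ≟ᶠ v)) * x w ≡ 0ℚ
    off-v w w≢v = trans (cong (λ b → 𝟙 b * x w) (dec-false (w ≟ᶠ v) w≢v)) (*-zeroˡ (x w))

  -- x_v = 1 and A_S x = 0: rescaling turns any null vector with x_v ≠ 0 into a solution.
  nullSystem : Fin n → List (AffineForm n)
  nullSystem v = pin v ∷ map adjRow (filter (_∈? S) (allFin n))

  nonzeroNull⇔solvable : ∀ v → (Σ (Fin n → ℚ) λ x → Null G S x × x v ≢ 0ℚ) ⇔ Solvable (nullSystem v)
  nonzeroNull⇔solvable v = mk⇔ forward backward
    where
    forward : (Σ (Fin n → ℚ) λ x → Null G S x × x v ≢ 0ℚ) → Solvable (nullSystem v)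
    forward (x , x-null , xᵥ≢0) = x′ , pinned ∷ map⁺ (All.tabulate rows)
      where
      xᵥ⁻¹ = 1/_ (x v) {{≢-nonZero xᵥ≢0}}
      x′ = λ w → xᵥ⁻¹ * x w
      pinned : eval (pin v) x′ ≡ 0ℚ
      pinned = trans (eval-pin v x′) (trans (cong (_- 1ℚ) (*-inverseˡ (x v) {{≢-nonZero xᵥ≢0}})) (+-inverseʳ 1ℚ))
      rows : ∀ {r} → r ∈ₗ filter (_∈? S) (allFin n) → eval (adjRow r) x′ ≡ 0ℚ
      rows {r} r∈ =
        trans (eval-adjRow r x′) (Null-*ˡ xᵥ⁻¹ x-null r (proj₂ (∈-filter⁻ (_∈? S) {xs = allFin n} r∈)))
    backward : Solvable (nullSystem v) → Σ (Fin n → ℚ) λ x → Null G S x × x v ≢ 0ℚ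
    backward (x , pinned ∷ rows) = x , x-null , xᵥ≢0
      where
      rows′ : All (λ r → eval (adjRow r) x ≡ 0ℚ) (filter (_∈? S) (allFin n))
      rows′ = map⁻ rows
      x-null : Null G S x
      x-null r r∈S = trans (sym (eval-adjRow r x)) (All.lookup rows′ (∈-filter⁺ (_∈? S) (∈-allFin r) r∈S))
      xᵥ≢0 : x v ≢ 0ℚ
      xᵥ≢0 xᵥ≡0 = -1≢0 (trans (cong (_- 1ℚ) (sym xᵥ≡0)) (trans (sym (eval-pin v x)) pinned))
        where
        -1≢0 : 0ℚ - 1ℚ ≢ 0ℚ
        -1≢0 ()

  Supp? : ∀ v → Dec (Supp G S v)
  Supp? v = Dec-map′ (λ (v∈S , sol) → v∈S , from sol) (λ (v∈S , x) → v∈S , to x)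
                     ((v ∈? S) ×-dec solvable? (nullSystem v))
    where open Equivalence (nonzeroNull⇔solvable v)

Adj-sym : ∀ {n} (G : Graph n) {u v} → Adj G u v → Adj G v u
Adj-sym G {u} {v} = subst T (Graph.sym G u v)

Unique⇒length≤ : ∀ {n} {xs : List (Fin n)} → Unique xs → length xs ≤ n
Unique⇒length≤ unique = injective⇒≤ (lookup-injective unique _ _)
  where
  lookup-injective : ∀ {xs : List (Fin _)} → Unique xs → ∀ i j → lookup xs i ≡ lookup xs j → i ≡ j
  lookup-injective (_ ∷ _)      zero    zero    _  = refl
  lookup-injective (x∉xs ∷ _)   zero    (suc j) eq = ⊥-elim (All.lookup x∉xs (∈-lookup j) eq)
  lookup-injective (x∉xs ∷ _)   (suc i) zero    eq = ⊥-elim (All.lookup x∉xs (∈-lookup i) (sym eq))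
  lookup-injective (_ ∷ unique) (suc i) (suc j) eq = cong suc (lookup-injective unique i j eq)

module _ {n : ℕ} {G : Graph n} {X : VPred n} where

  walk-end : ∀ {a b} → Walk G X a b → X b
  walk-end (stop xb)    = xb
  walk-end (step _ _ p) = walk-end p

  _▷_ : ∀ {a b c} → Walk G X a b → Adj G b c × X c → Walk G X a c
  stop xb       ▷ (b~c , xc) = step xb b~c (stop xc)
  step xa a~t p ▷ edge       = step xa a~t (p ▷ edge)

  departures : ∀ {a b} → Walk G X a b → List (Fin n)
  departures (stop _)         = []
  departures (step {u} _ _ p) = u ∷ departures p

  verts : ∀ {a b} → Walk G X a b → List (Fin n)
  verts {b = b} p = departures p ++ b ∷ []

  len : ∀ {a b} → Walk G X a b → ℕ
  len p = length (departures p)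

  IsPath : ∀ {a b} → Walk G X a b → Set
  IsPath p = Unique (verts p)

  All-verts : ∀ {a b} (p : Walk G X a b) → All X (verts p)
  All-verts (stop xb)     = xb ∷ []
  All-verts (step xa _ p) = xa ∷ All-verts p

  Linked-verts : ∀ {a b} (p : Walk G X a b) → Linked (Adj G) (verts p)
  Linked-verts (stop _)                    = [-]
  Linked-verts (step _ a~t (stop _))       = a~t ∷ [-]
  Linked-verts (step _ a~t p@(step _ _ _)) = a~t ∷ Linked-verts p

  path-len≤ : ∀ {a b} (p : Walk G X a b) → IsPath p → len p ≤ n
  path-len≤ p unique = ≤-trans (length-++-≤ˡ (departures p)) (Unique⇒length≤ unique)

  suffixFrom : ∀ {a c b} (q : Walk G X c b) → a ∈ₗ verts q → IsPath q → Σ (Walk G X a b) IsPath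
  suffixFrom (stop xb)       (here refl) unique       = stop xb , unique
  suffixFrom (step xc c~t q) (here refl) unique       = step xc c~t q , unique
  suffixFrom (step _ _ q)    (there a∈q) (_ ∷ unique) = suffixFrom q a∈q unique

  toPath : ∀ {a b} → Walk G X a b → Σ (Walk G X a b) IsPath
  toPath (stop xb) = stop xb , [] ∷ []
  toPath {a} (step xa a~t p) with toPath p
  ... | q , q-path with anyₗ? (a ≟ᶠ_) (verts q)
  ...   | yes a∈q = suffixFrom q a∈q q-path
  ...   | no  a∉q = step xa a~t q , ¬Any⇒All¬ _ a∉q ∷ q-path

  walk⇒cycle : ∀ {w s u} → Walk G X w s → (∀ {t} → X t → t ≢ u) → w ≢ s → Adj G s u → Adj G u w → HasCycle G
  walk⇒cycle p X∌u w≢s s~u u~w with toPath p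
  ... | stop _ , _ = ⊥-elim (w≢s refl)
  ... | q@(step _ _ _) , q-path =
    _ , departures q , _ , s≤s z≤n
      , All.map (λ xt → X∌u xt ∘ sym) (All-verts q) ∷ q-path
      , u~w ∷ Linked-verts q
      , s~u

  WalkWithin : ℕ → Fin n → Fin n → Set
  WalkWithin zero    a b = X a × a ≡ b
  WalkWithin (suc k) a b = WalkWithin zero a b ⊎ (X a × Σ (Fin n) λ t → Adj G a t × WalkWithin k t b)

  WalkWithin⇒Walk : ∀ k {a b} → WalkWithin k a b → Walk G X a b
  WalkWithin⇒Walk zero    (xa , refl)               = stop xa
  WalkWithin⇒Walk (suc k) (inj₁ (xa , refl))        = stop xa
  WalkWithin⇒Walk (suc k) (inj₂ (xa , _ , a~t , r)) = step xa a~t (WalkWithin⇒Walk k r)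

  Walk⇒WalkWithin : ∀ k {a b} (p : Walk G X a b) → len p ≤ k → WalkWithin k a b
  Walk⇒WalkWithin zero    (stop xa)       _           = xa , refl
  Walk⇒WalkWithin (suc k) (stop xa)       _           = inj₁ (xa , refl)
  Walk⇒WalkWithin (suc k) (step xa a~t p) (s≤s len≤k) = inj₂ (xa , _ , a~t , Walk⇒WalkWithin k p len≤k)

  module _ (X? : Decidable X) where

    walkWithin? : ∀ k a b → Dec (WalkWithin k a b)
    walkWithin? zero    a b = X? a ×-dec a ≟ᶠ b
    walkWithin? (suc k) a b =
      walkWithin? zero a b ⊎-dec (X? a ×-dec any? (λ t → T? (adj G a t) ×-dec walkWithin? k t b))

    -- Loop erasure bounds the length of a shortest walk by n.
    walk? : ∀ a b → Dec (Walk G X a b)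
    walk? a b = Dec-map′ (WalkWithin⇒Walk n) shortcut (walkWithin? n a b)
      where
      shortcut : Walk G X a b → WalkWithin n a b
      shortcut p = let q , q-path = toPath p in Walk⇒WalkWithin n q (path-len≤ q q-path)

subset : ∀ {n} {P : Fin n → Set} → Decidable P → Subset n
subset P? = tabulate (does ∘ P?)

∈-subset⁺ : ∀ {n} {P : Fin n → Set} (P? : Decidable P) {v} → P v → v ∈ subset P?
∈-subset⁺ P? {v} pv = lookup⇒[]= v _ (trans (lookup∘tabulate (does ∘ P?) v) (dec-true (P? v) pv))

∈-subset⁻ : ∀ {n} {P : Fin n → Set} (P? : Decidable P) {v} → v ∈ subset P? → P v
∈-subset⁻ P? {v} v∈ = decidable-stable (P? v) λ ¬pv → true≢false (begin
  true                     ≡⟨ []=⇒lookup v∈ ⟨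
  Vec.lookup (subset P?) v ≡⟨ lookup∘tabulate (does ∘ P?) v ⟩
  does (P? v)              ≡⟨ dec-false (P? v) ¬pv ⟩
  false                    ∎)
  where
  open ≡-Reasoning
  true≢false : true ≢ false
  true≢false ()

module _ {n : ℕ} {G : Graph n} {X : VPred n} where

  module _ {S : Subset n} (S-comp : IsComponent G X S) where

    private
      root-walk : ∀ {v} → v ∈ S → Walk G X (proj₁ S-comp) v
      root-walk {v} = proj₁ (proj₂ (proj₂ S-comp) v)

    component⊆ : ∀ {v} → v ∈ S → X v
    component⊆ = walk-end ∘ root-walk

    component-closed : ∀ {v t} → v ∈ S → Adj G v t → X t → t ∈ S
    component-closed {t = t} v∈S v~t xt = proj₂ (proj₂ (proj₂ S-comp) t) (root-walk v∈S ▷ (v~t , xt))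

  componentOf : Decidable X → ∀ {r} → X r → Σ (Subset n) λ S → IsComponent G X S × r ∈ S
  componentOf X? {r} xr = subset r? , (r , xr , λ _ → ∈-subset⁻ r? , ∈-subset⁺ r?) , ∈-subset⁺ r? (stop xr)
    where r? = walk? X? r

-- Flux of two null vectors out of a branch of a forest

if-split : ∀ b c (e : ℚ) → (if b then e else 0ℚ) ≡ (if b ∧ c then e else 0ℚ) + (if b ∧ not c then e else 0ℚ)
if-split true  true  e = sym (+-identityʳ e)
if-split true  false e = sym (+-identityˡ e)
if-split false _     _ = sym (+-identityˡ 0ℚ)

if-yes-no≡0 : ∀ {A C : Set} (a? : Dec A) (c? : Dec C) {e : ℚ} → (A → ¬ C → e ≡ 0ℚ) →
              (if does a? ∧ not (does c?) then e else 0ℚ) ≡ 0ℚ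
if-yes-no≡0 (yes a) (no ¬c) a∧¬c⇒e≡0 = a∧¬c⇒e≡0 a ¬c
if-yes-no≡0 (yes _) (yes _) _        = refl
if-yes-no≡0 (no _)  _       _        = refl

-- The rows indexed by B vanish and the B × B block cancels by antisymmetry, leaving the part
-- that crosses out of B.
boundarySum≡0 : ∀ {n} {B : Fin n → Set} (B? : Decidable B) (F : Fin n → Fin n → ℚ) →
                (∀ s → B s → Σℚ (F s) ≡ 0ℚ) → (∀ s t → B s → B t → F t s ≡ - F s t) →
                Σℚ (λ s → Σℚ (λ t → if does (B? s) ∧ not (does (B? t)) then F s t else 0ℚ)) ≡ 0ℚ
boundarySum≡0 {n} B? F rows antisym = begin
  ΣΣ boundary
    ≡⟨ +-identityˡ (ΣΣ boundary) ⟨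
  0ℚ + ΣΣ boundary
    ≡⟨ cong (_+ ΣΣ boundary) (ΣΣ-antisym≡0 interior interior-antisym) ⟨
  ΣΣ interior + ΣΣ boundary
    ≡⟨ Σℚ-+ (λ s → Σℚ (interior s)) (λ s → Σℚ (boundary s)) ⟨
  Σℚ (λ s → Σℚ (interior s) + Σℚ (boundary s))
    ≡⟨ Σℚ-cong (λ s → Σℚ-+ (interior s) (boundary s)) ⟨
  ΣΣ (λ s t → interior s t + boundary s t)
    ≡⟨ Σℚ-cong (λ s → Σℚ-cong (λ t → if-split (does (B? s)) (does (B? t)) (F s t))) ⟨
  ΣΣ (λ s t → if does (B? s) then F s t else 0ℚ)
    ≡⟨ Σℚ-zero inside-row ⟩
  0ℚ ∎
  where
  open ≡-Reasoning
  ΣΣ : (Fin n → Fin n → ℚ) → ℚ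
  ΣΣ K = Σℚ (λ s → Σℚ (K s))
  interior boundary : Fin n → Fin n → ℚ
  interior s t = if does (B? s) ∧ does (B? t) then F s t else 0ℚ
  boundary s t = if does (B? s) ∧ not (does (B? t)) then F s t else 0ℚ
  interior-antisym : ∀ s t → interior t s ≡ - interior s t
  interior-antisym s t with B? s | B? t
  ... | yes bs | yes bt = antisym s t bs bt
  ... | yes _  | no _   = refl
  ... | no _   | yes _  = refl
  ... | no _   | no _   = refl
  inside-row : ∀ s → Σℚ (λ t → if does (B? s) then F s t else 0ℚ) ≡ 0ℚ
  inside-row s with B? s
  ... | yes bs = rows s bs
  ... | no _   = Σℚ-zero {n} (λ _ → refl)

module _ {n : ℕ} (G : Graph n) (S : Subset n) (x y : Fin n → ℚ) where

  flux : Fin n → Fin n → ℚ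
  flux s t = if adj G s t ∧ does (t ∈? S) then y s * x t - x s * y t else 0ℚ

  Σflux≡0 : Null G S x → Null G S y → ∀ s → s ∈ S → Σℚ (flux s) ≡ 0ℚ
  Σflux≡0 x-null y-null s s∈S = begin
    Σℚ (flux s)
      ≡⟨ Σℚ-cong (λ t → expand (adj G s t ∧ does (t ∈? S)) (x s) (y s) (x t) (y t)) ⟩
    Σℚ (λ t → y s * adjTerm G S x s t + (- x s) * adjTerm G S y s t)
      ≡⟨ Σℚ-linear (y s) (- x s) (adjTerm G S x s) (adjTerm G S y s) ⟩
    y s * adjSum G S x s + (- x s) * adjSum G S y s
      ≡⟨ cong₂ (λ a b → y s * a + (- x s) * b) (x-null s s∈S) (y-null s s∈S) ⟩
    y s * 0ℚ + (- x s) * 0ℚ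
      ≡⟨ vanish (y s) (x s) ⟩
    0ℚ ∎
    where
    open ≡-Reasoning
    vanish : ∀ a b → a * 0ℚ + (- b) * 0ℚ ≡ 0ℚ
    vanish = solve-∀ ℚ-ring
    expand : ∀ b xs ys xt yt → (if b then ys * xt - xs * yt else 0ℚ)
                              ≡ ys * (if b then xt else 0ℚ) + (- xs) * (if b then yt else 0ℚ)
    expand true  xs ys xt yt = distrib xs ys xt yt
      where
      distrib : ∀ xs ys xt yt → ys * xt - xs * yt ≡ ys * xt + (- xs) * yt
      distrib = solve-∀ ℚ-ring
    expand false xs ys _ _ = sym (vanish ys xs)

  flux-antisym : ∀ s t → s ∈ S → t ∈ S → flux t s ≡ - flux s t
  flux-antisym s t s∈S t∈S rewrite dec-true (s ∈? S) s∈S | dec-true (t ∈? S) t∈S | Graph.sym G t s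
    with adj G s t
  ... | true  = swap (x s) (y s) (x t) (y t)
    where
    swap : ∀ xs ys xt yt → yt * xs - xt * ys ≡ - (ys * xt - xs * yt)
    swap = solve-∀ ℚ-ring
  ... | false = refl

  flux-on : ∀ {s t} → Adj G s t → t ∈ S → flux s t ≡ y s * x t - x s * y t
  flux-on {s} {t} s~t t∈S rewrite dec-true (t ∈? S) t∈S | Equivalence.to T-≡ s~t = refl

  flux-off : ∀ s t → (Adj G s t → t ∈ S → ⊥) → flux s t ≡ 0ℚ
  flux-off s t no-edge with adj G s t | t ∈? S
  ... | false | _       = refl
  ... | true  | no _    = refl
  ... | true  | yes t∈S = ⊥-elim (no-edge _ t∈S)

_∖_ : ∀ {n} → Subset n → Fin n → VPred n
(S ∖ u) t = t ∈ S × t ≢ u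

_∖?_ : ∀ {n} (S : Subset n) (u : Fin n) → Decidable (S ∖ u)
(S ∖? u) t = t ∈? S ×-dec ¬? (t ≟ᶠ u)

branch-exit : ∀ {n} {G : Graph n} → ¬ HasCycle G → ∀ {S w u s t} → Adj G u w →
              Walk G (S ∖ u) w s → ¬ Walk G (S ∖ u) w t → Adj G s t → t ∈ S → s ≡ w × t ≡ u
branch-exit acyclic {S} {w} {u} {s} {t} u~w p ¬q s~t t∈S with t ≟ᶠ u
... | no t≢u   = ⊥-elim (¬q (p ▷ (s~t , t∈S , t≢u)))
... | yes refl = decidable-stable (s ≟ᶠ w) (λ s≢w → acyclic (walk⇒cycle p proj₂ (s≢w ∘ sym) s~t u~w)) , refl

-- Sum the flux out of the branch of S ∖ u containing w; by acyclicity its only exit edge is wu.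
null-proportional-on-edge : ∀ {n} {G : Graph n} → ¬ HasCycle G → ∀ {S x y} → Null G S x → Null G S y →
                   ∀ {w u} → w ∈ S → u ∈ S → Adj G w u → y w * x u ≡ x w * y u
null-proportional-on-edge {n} {G} acyclic {S} {x} {y} x-null y-null {w} {u} w∈S u∈S w~u =
  x∙y⁻¹≈ε⇒x≈y (y w * x u) (x w * y u) (begin
    y w * x u - x w * y u       ≡⟨ boundary-at ⟨
    boundary w u                ≡⟨ Σℚ-δ u (λ t t≢u → boundary-off w t (t≢u ∘ proj₂)) ⟨
    Σℚ (boundary w)             ≡⟨ Σℚ-δ w (λ s s≢w → Σℚ-zero (λ t → boundary-off s t (s≢w ∘ proj₁))) ⟨
    Σℚ (λ s → Σℚ (boundary s))  ≡⟨ boundarySum≡0 B? (flux G S x y) rows antisym ⟩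
    0ℚ                          ∎)
  where
  open ≡-Reasoning
  u~w = Adj-sym G w~u
  w≢u : w ≢ u
  w≢u refl = subst T (Graph.irrefl G w) w~u
  B? = walk? {G = G} (S ∖? u) w
  rows : ∀ s → Walk G (S ∖ u) w s → Σℚ (flux G S x y s) ≡ 0ℚ
  rows s p = Σflux≡0 G S x y x-null y-null s (proj₁ (walk-end p))
  antisym : ∀ s t → Walk G (S ∖ u) w s → Walk G (S ∖ u) w t → flux G S x y t s ≡ - flux G S x y s t
  antisym s t p q = flux-antisym G S x y s t (proj₁ (walk-end p)) (proj₁ (walk-end q))
  boundary : Fin n → Fin n → ℚ
  boundary s t = if does (B? s) ∧ not (does (B? t)) then flux G S x y s t else 0ℚ
  boundary-off : ∀ s t → ¬ (s ≡ w × t ≡ u) → boundary s t ≡ 0ℚ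
  boundary-off s t off = if-yes-no≡0 (B? s) (B? t) λ p ¬q →
    flux-off G S x y s t (λ s~t t∈S → off (branch-exit acyclic u~w p ¬q s~t t∈S))
  boundary-at : boundary w u ≡ y w * x u - x w * y u
  boundary-at = trans (cong₂ (λ b c → if b ∧ not c then flux G S x y w u else 0ℚ)
                             (dec-true (B? w) (stop (w∈S , w≢u)))
                             (dec-false (B? u) (λ p → proj₂ (walk-end p) refl)))
                      (flux-on G S x y w~u u∈S)

-- Components of T⟨N[Supp T]⟩

ClosedNbhd? : ∀ {n} (G : Graph n) {P : VPred n} → Decidable P → Decidable (ClosedNbhd G P)
ClosedNbhd? G P? v = any? (λ u → P? u ×-dec (u ≟ᶠ v ⊎-dec T? (adj G u v)))

module _ {n : ℕ} (G : Graph n) (S : Subset n) where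

  Null-restrict : ∀ {x} → (∀ {v w} → v ∈ S → Adj G v w → w ∉ S → x w ≡ 0ℚ) → Null G ⊤ x → Null G S x
  Null-restrict {x} outside≡0 x-null v v∈S = trans (Σℚ-cong agree) (x-null v ∈⊤)
    where
    agree : ∀ w → adjTerm G S x v w ≡ adjTerm G ⊤ x v w
    agree w rewrite dec-true (w ∈? ⊤) ∈⊤ with adj G v w in v~w | w ∈? S
    ... | false | _       = refl
    ... | true  | yes _   = refl
    ... | true  | no  w∉S = sym (outside≡0 v∈S (Equivalence.from T-≡ v~w) w∉S)

  Null-extend : ∀ {x} → (∀ {v w} → v ∉ S → Adj G v w → w ∈ S → x w ≡ 0ℚ) → Null G S x → Null G ⊤ (extend S x)
  Null-extend {x} boundary≡0 x-null v _ with v ∈? S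
  ... | yes v∈S = trans (Σℚ-cong agree) (x-null v v∈S)
    where
    agree : ∀ w → adjTerm G ⊤ (extend S x) v w ≡ adjTerm G S x v w
    agree w rewrite dec-true (w ∈? ⊤) ∈⊤ with adj G v w
    ... | false = refl
    ... | true  = refl
  ... | no v∉S = Σℚ-zero vanish
    where
    vanish : ∀ w → adjTerm G ⊤ (extend S x) v w ≡ 0ℚ
    vanish w rewrite dec-true (w ∈? ⊤) ∈⊤ with adj G v w in v~w | w ∈? S
    ... | false | _       = refl
    ... | true  | no _    = refl
    ... | true  | yes w∈S = boundary≡0 v∉S (Equivalence.from T-≡ v~w) w∈S

  extend-∈ : ∀ x {w} → w ∈ S → extend S x w ≡ x w
  extend-∈ x {w} w∈S = cong (λ b → if b then x w else 0ℚ) (dec-true (w ∈? S) w∈S)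

  Supp-restrict : (∀ x → Null G ⊤ x → Null G S x) → (∀ x → Null G S x → Null G ⊤ (extend S x)) →
                  ∀ w → Supp G S w ⇔ (Supp G ⊤ w × w ∈ S)
  Supp-restrict restrict extend-null w = mk⇔ forward backward
    where
    forward : Supp G S w → Supp G ⊤ w × w ∈ S
    forward (w∈S , x , x-null , xw≢0) =
      (∈⊤ , extend S x , extend-null x x-null , xw≢0 ∘ trans (sym (extend-∈ x w∈S))) , w∈S
    backward : Supp G ⊤ w × w ∈ S → Supp G S w
    backward ((_ , x , x-null , xw≢0) , w∈S) = w∈S , x , restrict x x-null , xw≢0

  Core-restrict : (∀ w → Supp G S w ⇔ (Supp G ⊤ w × w ∈ S)) →
                  (∀ {u w} → Supp G ⊤ u → Adj G u w → w ∈ S → u ∈ S) →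
                  ∀ w → Core G S w ⇔ (Core G ⊤ w × w ∈ S)
  Core-restrict supp⇔ support-closed w = mk⇔ forward backward
    where
    forward : Core G S w → Core G ⊤ w × w ∈ S
    forward (w∈S , u , su , u~w) = (∈⊤ , u , proj₁ (Equivalence.to (supp⇔ u) su) , u~w) , w∈S
    backward : Core G ⊤ w × w ∈ S → Core G S w
    backward ((_ , u , su , u~w) , w∈S) =
      w∈S , u , Equivalence.from (supp⇔ u) (su , support-closed su u~w w∈S) , u~w

module SupportComponents {n : ℕ} {T : Graph n} (acyclic : ¬ HasCycle T) where

  module _ (S : Subset n) (S∈F : InFS T S) where

    private
      closed : ∀ {v t} → v ∈ S → Adj T v t → ClosedNbhd T (Supp T ⊤) t → t ∈ S
      closed = component-closed S∈F

    component-null-restrict : ∀ x → Null T ⊤ x → Null T S x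
    component-null-restrict x x-null = Null-restrict T S outside≡0 x-null
      where
      outside≡0 : ∀ {v w} → v ∈ S → Adj T v w → w ∉ S → x w ≡ 0ℚ
      outside≡0 {w = w} v∈S v~w w∉S =
        decidable-stable (x w ≟ 0ℚ) λ xw≢0 → w∉S (closed v∈S v~w (w , (∈⊤ , x , x-null , xw≢0) , inj₁ refl))

    null-vanishes-at-exit : ∀ {x} → Null T S x → ∀ {w v} → w ∈ S → Adj T w v → v ∉ S → x w ≡ 0ℚ
    null-vanishes-at-exit {x} x-null {w} {v} w∈S w~v v∉S with component⊆ S∈F w∈S
    ... | u , su , inj₁ refl = ⊥-elim (v∉S (closed w∈S w~v (u , su , inj₂ w~v)))
    ... | u , su@(_ , y , y-null , yu≢0) , inj₂ u~w = p*q≡0⇒p≡0 (x w) (y u) yu≢0 (begin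
      x w * y u  ≡⟨ null-proportional-on-edge {G = T} acyclic x-null (component-null-restrict y y-null)
                                               w∈S u∈S (Adj-sym T u~w) ⟨
      y w * x u  ≡⟨ cong (_* x u) yw≡0 ⟩
      0ℚ * x u   ≡⟨ *-zeroˡ (x u) ⟩
      0ℚ         ∎)
      where
      open ≡-Reasoning
      u∈S : u ∈ S
      u∈S = closed w∈S (Adj-sym T u~w) (u , su , inj₁ refl)
      yw≡0 : y w ≡ 0ℚ
      yw≡0 = decidable-stable (y w ≟ 0ℚ) λ yw≢0 →
        v∉S (closed w∈S w~v (w , (∈⊤ , y , y-null , yw≢0) , inj₂ w~v))

    component-null-extend : ∀ x → Null T S x → Null T ⊤ (extend S x)
    component-null-extend x x-null =
      Null-extend T S (λ v∉S v~w w∈S → null-vanishes-at-exit x-null w∈S (Adj-sym T v~w) v∉S) x-null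

    component-Supp : ∀ w → Supp T S w ⇔ (Supp T ⊤ w × w ∈ S)
    component-Supp = Supp-restrict T S component-null-restrict component-null-extend

    component-Core : ∀ w → Core T S w ⇔ (Core T ⊤ w × w ∈ S)
    component-Core =
      Core-restrict T S component-Supp λ su u~w w∈S → closed w∈S (Adj-sym T u~w) (_ , su , inj₁ refl)

  private
    componentOf-N[Supp] : ∀ {r} → ClosedNbhd T (Supp T ⊤) r → Σ (Subset n) λ S → InFS T S × r ∈ S
    componentOf-N[Supp] = componentOf (ClosedNbhd? T (Supp? T ⊤))

  Supp-⋃ : ∀ w → Supp T ⊤ w ⇔ Σ (Subset n) (λ S → InFS T S × Supp T S w)
  Supp-⋃ w = mk⇔ forward backward
    where
    forward : Supp T ⊤ w → Σ (Subset n) (λ S → InFS T S × Supp T S w)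
    forward sw with componentOf-N[Supp] (w , sw , inj₁ refl)
    ... | S , S∈F , w∈S = S , S∈F , Equivalence.from (component-Supp S S∈F w) (sw , w∈S)
    backward : Σ (Subset n) (λ S → InFS T S × Supp T S w) → Supp T ⊤ w
    backward (S , S∈F , sw) = proj₁ (Equivalence.to (component-Supp S S∈F w) sw)

  Core-⋃ : ∀ w → Core T ⊤ w ⇔ Σ (Subset n) (λ S → InFS T S × Core T S w)
  Core-⋃ w = mk⇔ forward backward
    where
    forward : Core T ⊤ w → Σ (Subset n) (λ S → InFS T S × Core T S w)
    forward cw@(_ , u , su , u~w) with componentOf-N[Supp] (u , su , inj₁ refl)
    ... | S , S∈F , u∈S = S , S∈F , Equivalence.from (component-Core S S∈F w)
                                      (cw , component-closed S∈F u∈S u~w (u , su , inj₂ u~w))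
    backward : Σ (Subset n) (λ S → InFS T S × Core T S w) → Core T ⊤ w
    backward (S , S∈F , cw) = proj₁ (Equivalence.to (component-Core S S∈F w) cw)

mainTheorem13 : ∀ {n : ℕ} (T : Graph n) → IsTree T → (S : Subset n) → InFS T S →
    (∀ w → Supp T S w ⇔ (Supp T ⊤ w × w ∈ S))
    × (∀ w → Supp T ⊤ w ⇔ Σ (Subset n) (λ S′ → InFS T S′ × Supp T S′ w))
    × (∀ w → Core T S w ⇔ (Core T ⊤ w × w ∈ S))
    × (∀ w → Core T ⊤ w ⇔ Σ (Subset n) (λ S′ → InFS T S′ × Core T S′ w))
    × (∀ (x : Fin n → ℚ) → Null T ⊤ x → Null T S x)
    × (∀ (x : Fin n → ℚ) → Null T S x → Null T ⊤ (extend S x))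
mainTheorem13 T (_ , _ , acyclic) S S∈F =
    component-Supp S S∈F , Supp-⋃ , component-Core S S∈F , Core-⋃
  , component-null-restrict S S∈F , component-null-extend S S∈F
  where open SupportComponents acyclic
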